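{- Let $n\ge 4$ and let $S$ be a set of vertices of the folded hypercube $FQ_n$ whose characteristic matrix $X(S)$ has a zero row and distinct, nonzero columns. If either (1) $n$ is even, or (2) $n\equiv 1\pmod 4$ and the column sum of $X(S)$ is not one of the columns of $X(S)$, or (3) $n\equiv 3\pmod 4$ and the column sum of $X(S)$ is not $\mathbf{0}$, then $S$ is a determining set for $FQ_n$.
   Context: $FQ_n$ has vertex set $\mathbb{Z}_2^n$, two vertices adjacent iff they differ in exactly one position or in all $n$ positions. A determining set is a vertex set such that the only automorphism fixing each of its vertices is the identity. For an ordered set $S=\{\mathbf{v}_1,\dots,\mathbf{v}_r\}$, the characteristic matrix $X(S)$ is the $r\times n$ binary matrix whose $(t,j)$ entry is the $j$-th position of $\mathbf{v}_t$; the column sum is the sum of its $n$ columns in $\mathbb{Z}_2^r$. -}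

module Defs where

open import Data.Nat using (ℕ; zero; suc; _+_)
open import Data.Bool using (Bool; true; false; _xor_; if_then_else_)
open import Data.Vec using (Vec; []; _∷_; lookup; map; zipWith; replicate; foldr; tabulate)
open import Data.Fin using (Fin)
open import Data.Sum using (_⊎_)
open import Data.Product using (Σ; _×_)
open import Relation.Binary.PropositionalEquality using (_≡_)

Vertex : ℕ → Set
Vertex n = Vec Bool n

hamming : ∀ {n} → Vertex n → Vertex n → ℕ
hamming [] [] = 0
hamming (x ∷ xs) (y ∷ ys) = (if x xor y then 1 else 0) + hamming xs ys

Adj : (n : ℕ) → Vertex n → Vertex n → Set
Adj n u v = (hamming u v ≡ 1) ⊎ (hamming u v ≡ n)

record Automorphism (n : ℕ) : Set where
  field
    to       : Vertex n → Vertex n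
    from     : Vertex n → Vertex n
    to-from  : ∀ x → to (from x) ≡ x
    from-to  : ∀ x → from (to x) ≡ x
    adj-to   : ∀ u v → Adj n u v → Adj n (to u) (to v)
    adj-from : ∀ u v → Adj n (to u) (to v) → Adj n u v
open Automorphism public

IsDeterminingSet : ∀ {r} (n : ℕ) → Vec (Vertex n) r → Set
IsDeterminingSet n S =
  (φ : Automorphism n) → (∀ t → to φ (lookup S t) ≡ lookup S t) → ∀ x → to φ x ≡ x

X : ∀ {r n} → Vec (Vertex n) r → Fin r → Fin n → Bool
X S t j = lookup (lookup S t) j

column : ∀ {r n} → Vec (Vertex n) r → Fin n → Vec Bool r
column S j = tabulate (λ t → X S t j)

row : ∀ {r n} → Vec (Vertex n) r → Fin r → Vec Bool n
row S t = tabulate (λ j → X S t j)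

columnSum : ∀ {r n} → Vec (Vertex n) r → Vec Bool r
columnSum {r} {n} S = tabulate (λ t → foldr (λ _ → Bool) _xor_ false (row S t))

-- Identify Z₂ⁿ with Z₂ⁿ⁺¹ modulo the all-ones word by reading a word relative to its first letter.  Then
-- FQ_n is the Cayley graph of Z₂ⁿ whose n + 1 generators, the directions, are the images of the unit
-- words of Z₂ⁿ⁺¹.  For n ≥ 4 two vertices at distance two have exactly two common neighbours, which
-- forces an automorphism φ fixing 0 (S contains the zero word) to be additive and to permute the
-- directions, so φ lifts to a coordinate permutation π of Z₂ⁿ⁺¹.  A vertex s fixed by φ lifts to ŝ = 0s
-- with ŝ ∘ π = ŝ + c·1, where c is the entry of ŝ at π(0).  If π(0) = 0 then c = 0 for all s ∈ S, and
-- since the columns of X(S) together with a zero column are distinct, π and hence φ is the identity.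
-- Otherwise π(0) = j + 1 and c runs through column j, which is nonzero.  A row with c = 1 is complemented
-- by π, so has weight (n + 1)/2; this is impossible for n even, and otherwise makes the parity of every
-- row equal to c times the parity of (n + 1)/2: the column sum is column j if n ≡ 1 (mod 4) and 0 if
-- n ≡ 3 (mod 4).
module Submission where

open import Defs
open import Data.Bool using (Bool; true; false; not; _∧_; _xor_; if_then_else_)
open import Data.Bool.Properties
  using ( xor-same; xor-assoc; xor-comm; xor-identityˡ; xor-identityʳ; not-distribˡ-xor; not-distribʳ-xor
        ; xor-annihilates-not; not-¬; not-involutive; ∧-identityʳ; ∧-zeroʳ)
open import Data.Empty using (⊥; ⊥-elim)
open import Data.Fin using (Fin; zero; suc; _≟_)
open import Data.Fin.Permutation using (Permutation′; permutation; _⟨$⟩ʳ_; _⟨$⟩ˡ_; inverseˡ; inverseʳ)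
open import Data.Nat using (ℕ; zero; suc; _+_; _≤_; z≤n; s≤s)
open import Data.Nat.DivMod using (_%_; [m+n]%n≡m%n; m∣n⇒o%n%m≡o%m)
open import Data.Nat.Divisibility using (divides)
open import Data.Nat.Properties
  using (+-0-commutativeMonoid; +-suc; suc-injective; ≤-refl; ≤-trans; m≤n⇒m≤1+n; n≤1+n; +-mono-≤; <-irrefl)
open import Algebra.Properties.CommutativeMonoid.Sum +-0-commutativeMonoid using (sum; sum-cong-≗; sum-permute)
open import Data.Nat.Tactic.RingSolver using (solve-∀)
open import Data.Product using (Σ; ∃; _×_; _,_; proj₁; proj₂)
open import Data.Sum using (_⊎_; inj₁; inj₂)
open import Data.Vec using (Vec; []; _∷_; head; lookup; replicate; zipWith; map; tabulate; foldr)
open import Data.Vec.Properties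
  using ( zipWith-assoc; zipWith-comm; zipWith-identityˡ; zipWith-identityʳ; zipWith-replicate
        ; ∷-injectiveˡ; ∷-injectiveʳ; lookup-zipWith; lookup-replicate; lookup∘tabulate; tabulate∘lookup
        ; map-id; map-replicate)
open import Data.Vec.Relation.Binary.Pointwise.Extensional using (ext; Pointwise-≡⇒≡)
open import Function using (_∘_)
open import Relation.Nullary using (¬_; yes; no; contradiction)
open import Relation.Binary.PropositionalEquality

private variable
  n : ℕ

lookup-ext : {u v : Vec Bool n} → (∀ i → lookup u i ≡ lookup v i) → u ≡ v
lookup-ext eq = Pointwise-≡⇒≡ (ext eq)

xor-interchange : ∀ a b c d → (a xor b) xor (c xor d) ≡ (a xor c) xor (b xor d)
xor-interchange false false c d = refl
xor-interchange false true  c d = not-distribʳ-xor c d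
xor-interchange true  false c d = not-distribˡ-xor c d
xor-interchange true  true  c d = sym (xor-annihilates-not c d)

xor≡false⇒≡ : ∀ {a b} → a xor b ≡ false → b ≡ a
xor≡false⇒≡ {false} {false} _ = refl
xor≡false⇒≡ {true}  {true}  _ = refl

infixl 6 _⊕_

_⊕_ : Vertex n → Vertex n → Vertex n
_⊕_ = zipWith _xor_

zeros : Vertex n
zeros = replicate _ false

ones : Vertex n
ones = replicate _ true

⊕-assoc : (x y z : Vertex n) → x ⊕ y ⊕ z ≡ x ⊕ (y ⊕ z)
⊕-assoc = zipWith-assoc xor-assoc

⊕-comm : (x y : Vertex n) → x ⊕ y ≡ y ⊕ x
⊕-comm = zipWith-comm xor-comm

⊕-identityˡ : (x : Vertex n) → zeros ⊕ x ≡ x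
⊕-identityˡ = zipWith-identityˡ xor-identityˡ

⊕-identityʳ : (x : Vertex n) → x ⊕ zeros ≡ x
⊕-identityʳ = zipWith-identityʳ xor-identityʳ

⊕-self : (x : Vertex n) → x ⊕ x ≡ zeros
⊕-self []      = refl
⊕-self (b ∷ x) = cong₂ _∷_ (xor-same b) (⊕-self x)

⊕-interchange : (a b c d : Vertex n) → (a ⊕ b) ⊕ (c ⊕ d) ≡ (a ⊕ c) ⊕ (b ⊕ d)
⊕-interchange []      []      []      []      = refl
⊕-interchange (a ∷ u) (b ∷ v) (c ∷ w) (d ∷ x) = cong₂ _∷_ (xor-interchange a b c d) (⊕-interchange u v w x)

x⊕[x⊕y]≡y : (x y : Vertex n) → x ⊕ (x ⊕ y) ≡ y
x⊕[x⊕y]≡y x y = trans (sym (⊕-assoc x x y)) (trans (cong (_⊕ y) (⊕-self x)) (⊕-identityˡ y))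

x⊕y⊕y≡x : (x y : Vertex n) → x ⊕ y ⊕ y ≡ x
x⊕y⊕y≡x x y = trans (⊕-assoc x y y) (trans (cong (x ⊕_) (⊕-self y)) (⊕-identityʳ x))

⊕≡⇒≡⊕ : (x : Vertex n) {y z : Vertex n} → x ⊕ y ≡ z → y ≡ x ⊕ z
⊕≡⇒≡⊕ x {y} eq = trans (sym (x⊕[x⊕y]≡y x y)) (cong (x ⊕_) eq)

⊕-cancelˡ : (x : Vertex n) {y z : Vertex n} → x ⊕ y ≡ x ⊕ z → y ≡ z
⊕-cancelˡ x {z = z} eq = trans (⊕≡⇒≡⊕ x eq) (x⊕[x⊕y]≡y x z)

⊕-cancelʳ : (x : Vertex n) {y z : Vertex n} → y ⊕ x ≡ z ⊕ x → y ≡ z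
⊕-cancelʳ x {y} {z} eq = ⊕-cancelˡ x (trans (⊕-comm x y) (trans eq (⊕-comm z x)))

⊕≡zeros⇒≡ : {x y : Vertex n} → x ⊕ y ≡ zeros → x ≡ y
⊕≡zeros⇒≡ {x = x} {y} eq = ⊕-cancelʳ y (trans eq (sym (⊕-self y)))

e : Fin n → Vertex n
e zero    = true ∷ zeros
e (suc j) = false ∷ e j

dir : Fin (suc n) → Vertex n
dir zero    = ones
dir (suc j) = e j

e-injective : {i j : Fin n} → e i ≡ e j → i ≡ j
e-injective {i = zero}  {zero}  _  = refl
e-injective {i = zero}  {suc j} eq = contradiction (∷-injectiveˡ eq) λ ()
e-injective {i = suc i} {zero}  eq = contradiction (∷-injectiveˡ eq) λ ()
e-injective {i = suc i} {suc j} eq = cong suc (e-injective (∷-injectiveʳ eq))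

lookup-e-diag : (j : Fin n) → lookup (e j) j ≡ true
lookup-e-diag zero    = refl
lookup-e-diag (suc j) = lookup-e-diag j

lookup-e-≢ : {i j : Fin n} → j ≢ i → lookup (e j) i ≡ false
lookup-e-≢ {i = zero}  {zero}  j≢i = contradiction refl j≢i
lookup-e-≢ {i = suc i} {zero}  _   = lookup-replicate i false
lookup-e-≢ {i = zero}  {suc j} _   = refl
lookup-e-≢ {i = suc i} {suc j} j≢i = lookup-e-≢ (j≢i ∘ cong suc)

lookup-e-true : {i j : Fin n} → lookup (e j) i ≡ true → j ≡ i
lookup-e-true {i = i} {j} eq with j ≟ i
... | yes j≡i = j≡i
... | no  j≢i = contradiction (trans (sym eq) (lookup-e-≢ j≢i)) λ ()

⊕-e-induction : ∀ {ℓ} (P : Vertex n → Set ℓ) → P zeros → (∀ x j → P x → P (x ⊕ e j)) → ∀ x → P x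
⊕-e-induction P base step []      = base
⊕-e-induction P base step (b ∷ x) =
  prepend b (⊕-e-induction (λ y → P (false ∷ y)) base (λ y j → step (false ∷ y) (suc j)) x)
  where
    prepend : ∀ b → P (false ∷ x) → P (b ∷ x)
    prepend false p = p
    prepend true  p = subst P (cong (true ∷_) (⊕-identityʳ x)) (step (false ∷ x) zero p)

weight : Vertex n → ℕ
weight []      = 0
weight (b ∷ x) = (if b then 1 else 0) + weight x

hamming≡weight-⊕ : (u v : Vertex n) → hamming u v ≡ weight (u ⊕ v)
hamming≡weight-⊕ []      []      = refl
hamming≡weight-⊕ (a ∷ u) (b ∷ v) = cong ((if a xor b then 1 else 0) +_) (hamming≡weight-⊕ u v)

weight≤length : (x : Vertex n) → weight x ≤ n
weight≤length []          = z≤n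
weight≤length (true  ∷ x) = s≤s (weight≤length x)
weight≤length (false ∷ x) = m≤n⇒m≤1+n (weight≤length x)

weight-ones : weight (ones {n}) ≡ n
weight-ones {zero}  = refl
weight-ones {suc n} = cong suc weight-ones

weight-zeros : weight (zeros {n}) ≡ 0
weight-zeros {zero}  = refl
weight-zeros {suc n} = weight-zeros {n}

weight-e : (j : Fin n) → weight (e j) ≡ 1
weight-e {suc n} zero    = cong suc (weight-zeros {n})
weight-e         (suc j) = weight-e j

weight-⊕-≤ : (x y : Vertex n) → weight (x ⊕ y) ≤ weight x + weight y
weight-⊕-≤ []          []          = z≤n
weight-⊕-≤ (false ∷ x) (false ∷ y) = weight-⊕-≤ x y
weight-⊕-≤ (false ∷ x) (true  ∷ y) =
  subst (suc (weight (x ⊕ y)) ≤_) (sym (+-suc (weight x) (weight y))) (s≤s (weight-⊕-≤ x y))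
weight-⊕-≤ (true  ∷ x) (false ∷ y) = s≤s (weight-⊕-≤ x y)
weight-⊕-≤ (true  ∷ x) (true  ∷ y) =
  m≤n⇒m≤1+n (≤-trans (weight-⊕-≤ x y) (+-mono-≤ {weight x} ≤-refl (n≤1+n (weight y))))

weight-e⊕e≤2 : (i j : Fin n) → weight (e i ⊕ e j) ≤ 2
weight-e⊕e≤2 i j = subst (weight (e i ⊕ e j) ≤_) (cong₂ _+_ (weight-e i) (weight-e j)) (weight-⊕-≤ (e i) (e j))

weight≡0⇒zeros : (x : Vertex n) → weight x ≡ 0 → x ≡ zeros
weight≡0⇒zeros []          _  = refl
weight≡0⇒zeros (false ∷ x) eq = cong (false ∷_) (weight≡0⇒zeros x eq)

weight≡1⇒e : (x : Vertex n) → weight x ≡ 1 → ∃ λ j → x ≡ e j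
weight≡1⇒e (true  ∷ x) eq = zero , cong (true ∷_) (weight≡0⇒zeros x (suc-injective eq))
weight≡1⇒e (false ∷ x) eq with weight≡1⇒e x eq
... | j , x≡e = suc j , cong (false ∷_) x≡e

weight≡length⇒ones : (x : Vertex n) → weight x ≡ n → x ≡ ones
weight≡length⇒ones []          _  = refl
weight≡length⇒ones (true  ∷ x) eq = cong (true ∷_) (weight≡length⇒ones x (suc-injective eq))
weight≡length⇒ones (false ∷ x) eq = contradiction (subst (_≤ _) eq (weight≤length x)) (<-irrefl refl)

weight-dir : (k : Fin (suc n)) → (weight (dir k) ≡ 1) ⊎ (weight (dir k) ≡ n)
weight-dir zero    = inj₂ weight-ones
weight-dir (suc j) = inj₁ (weight-e j)

Adj-⊕-dir : (u : Vertex n) (k : Fin (suc n)) → Adj n u (u ⊕ dir k)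
Adj-⊕-dir {n} u k =
  subst (λ w → (w ≡ 1) ⊎ (w ≡ n))
        (sym (trans (hamming≡weight-⊕ u (u ⊕ dir k)) (cong weight (x⊕[x⊕y]≡y u (dir k)))))
        (weight-dir k)

Adj⇒≡⊕-dir : {u v : Vertex n} → Adj n u v → ∃ λ k → v ≡ u ⊕ dir k
Adj⇒≡⊕-dir {u = u} {v} (inj₁ h≡1) with weight≡1⇒e (u ⊕ v) (trans (sym (hamming≡weight-⊕ u v)) h≡1)
... | j , eq = suc j , ⊕≡⇒≡⊕ u eq
Adj⇒≡⊕-dir {u = u} {v} (inj₂ h≡n) =
  zero , ⊕≡⇒≡⊕ u (weight≡length⇒ones (u ⊕ v) (trans (sym (hamming≡weight-⊕ u v)) h≡n))

project : Vertex (suc n) → Vertex n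
project (b ∷ x) = map (b xor_) x

project-⊕ : (u v : Vertex (suc n)) → project (u ⊕ v) ≡ project u ⊕ project v
project-⊕ (a ∷ x) (b ∷ y) = go x y
  where
    go : ∀ {m} (x y : Vertex m) → map ((a xor b) xor_) (x ⊕ y) ≡ map (a xor_) x ⊕ map (b xor_) y
    go []      []      = refl
    go (c ∷ x) (d ∷ y) = cong₂ _∷_ (xor-interchange a b c d) (go x y)

project-false∷ : (x : Vertex n) → project (false ∷ x) ≡ x
project-false∷ = map-id

project-e : (k : Fin (suc n)) → project (e k) ≡ dir k
project-e zero    = map-replicate not false _
project-e (suc j) = project-false∷ (e j)

project-e⊕e : (a b : Fin (suc n)) → project (e a ⊕ e b) ≡ dir a ⊕ dir b
project-e⊕e a b = trans (project-⊕ (e a) (e b)) (cong₂ _⊕_ (project-e a) (project-e b))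

project-kernel : (u : Vertex (suc n)) → project u ≡ zeros → u ≡ replicate (suc n) (head u)
project-kernel (b ∷ x) eq = cong (b ∷_) (tail-kernel x eq)
  where
    tail-kernel : ∀ {m} (x : Vertex m) → map (b xor_) x ≡ zeros → x ≡ replicate m b
    tail-kernel []      _  = refl
    tail-kernel (c ∷ x) eq = cong₂ _∷_ (xor≡false⇒≡ (∷-injectiveˡ eq)) (tail-kernel x (∷-injectiveʳ eq))

project≡zeros⇒≡zeros : (u : Vertex (suc n)) → weight u ≤ n → project u ≡ zeros → u ≡ zeros
project≡zeros⇒≡zeros (false ∷ x) _ eq = project-kernel (false ∷ x) eq
project≡zeros⇒≡zeros {n} (true ∷ x) light eq =
  contradiction (subst (λ w → weight w ≤ n) (project-kernel (true ∷ x) eq) light) (<-irrefl weight-ones)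

dir-injective : 2 ≤ n → {a b : Fin (suc n)} → dir a ≡ dir b → a ≡ b
dir-injective 2≤n {a} {b} eq =
  e-injective (⊕≡zeros⇒≡ (project≡zeros⇒≡zeros (e a ⊕ e b) (≤-trans (weight-e⊕e≤2 a b) 2≤n)
    (trans (project-e⊕e a b) (trans (cong (_⊕ dir b) eq) (⊕-self (dir b))))))

e-square : {α β γ δ : Fin n} → α ≢ β → e α ⊕ e γ ≡ e β ⊕ e δ → γ ≡ α ⊎ γ ≡ β
e-square {α = α} {β} {γ} {δ} α≢β eq with γ ≟ α | γ ≟ β
... | yes γ≡α | _       = inj₁ γ≡α
... | no _    | yes γ≡β = inj₂ γ≡β
... | no γ≢α  | no γ≢β  =
  contradiction (e-injective (⊕-cancelʳ (e γ) (trans eq (cong (λ j → e β ⊕ e j) δ≡γ)))) α≢β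
  where
    open ≡-Reasoning
    δ≡γ : δ ≡ γ
    δ≡γ = lookup-e-true (sym (begin
      true                              ≡⟨ cong₂ _xor_ (lookup-e-≢ (γ≢α ∘ sym)) (lookup-e-diag γ) ⟨
      lookup (e α) γ xor lookup (e γ) γ ≡⟨ lookup-zipWith _xor_ γ (e α) (e γ) ⟨
      lookup (e α ⊕ e γ) γ              ≡⟨ cong (λ w → lookup w γ) eq ⟩
      lookup (e β ⊕ e δ) γ              ≡⟨ lookup-zipWith _xor_ γ (e β) (e δ) ⟩
      lookup (e β) γ xor lookup (e δ) γ ≡⟨ cong (_xor lookup (e δ) γ) (lookup-e-≢ (γ≢β ∘ sym)) ⟩
      lookup (e δ) γ                    ∎))

-- The lifted sum has weight at most 4 < n + 1, so it cannot be the all-ones word.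
dir-square : 4 ≤ n → {α β γ δ : Fin (suc n)} → α ≢ β →
             dir α ⊕ dir γ ≡ dir β ⊕ dir δ → γ ≡ α ⊎ γ ≡ β
dir-square 4≤n {α} {β} {γ} {δ} α≢β eq =
  e-square α≢β (⊕≡zeros⇒≡ (project≡zeros⇒≡zeros ((e α ⊕ e γ) ⊕ (e β ⊕ e δ)) (≤-trans light 4≤n) projected))
  where
    open ≡-Reasoning
    light : weight ((e α ⊕ e γ) ⊕ (e β ⊕ e δ)) ≤ 4
    light = ≤-trans (weight-⊕-≤ (e α ⊕ e γ) (e β ⊕ e δ))
                    (+-mono-≤ (weight-e⊕e≤2 α γ) (weight-e⊕e≤2 β δ))
    projected : project ((e α ⊕ e γ) ⊕ (e β ⊕ e δ)) ≡ zeros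
    projected = begin
      project ((e α ⊕ e γ) ⊕ (e β ⊕ e δ))       ≡⟨ project-⊕ (e α ⊕ e γ) (e β ⊕ e δ) ⟩
      project (e α ⊕ e γ) ⊕ project (e β ⊕ e δ) ≡⟨ cong₂ _⊕_ (project-e⊕e α γ) (project-e⊕e β δ) ⟩
      (dir α ⊕ dir γ) ⊕ (dir β ⊕ dir δ)         ≡⟨ cong (_⊕ (dir β ⊕ dir δ)) eq ⟩
      (dir β ⊕ dir δ) ⊕ (dir β ⊕ dir δ)         ≡⟨ ⊕-self (dir β ⊕ dir δ) ⟩
      zeros                                     ∎

permute : Permutation′ n → Vertex n → Vertex n
permute π v = tabulate (λ i → lookup v (π ⟨$⟩ʳ i))

lookup-permute : (π : Permutation′ n) (v : Vertex n) (i : Fin n) → lookup (permute π v) i ≡ lookup v (π ⟨$⟩ʳ i)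
lookup-permute π v = lookup∘tabulate (λ i → lookup v (π ⟨$⟩ʳ i))

permute-⊕ : (π : Permutation′ n) (u v : Vertex n) → permute π (u ⊕ v) ≡ permute π u ⊕ permute π v
permute-⊕ π u v = lookup-ext λ i → begin
  lookup (permute π (u ⊕ v)) i                      ≡⟨ lookup-permute π (u ⊕ v) i ⟩
  lookup (u ⊕ v) (π ⟨$⟩ʳ i)                         ≡⟨ lookup-zipWith _xor_ (π ⟨$⟩ʳ i) u v ⟩
  lookup u (π ⟨$⟩ʳ i) xor lookup v (π ⟨$⟩ʳ i)       ≡⟨ cong₂ _xor_ (lookup-permute π u i) (lookup-permute π v i) ⟨
  lookup (permute π u) i xor lookup (permute π v) i ≡⟨ lookup-zipWith _xor_ i (permute π u) (permute π v) ⟨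
  lookup (permute π u ⊕ permute π v) i              ∎
  where open ≡-Reasoning

permute-replicate : (π : Permutation′ n) (b : Bool) → permute π (replicate n b) ≡ replicate n b
permute-replicate {n} π b = lookup-ext λ i →
  trans (lookup-permute π (replicate n b) i) (trans (lookup-replicate (π ⟨$⟩ʳ i) b) (sym (lookup-replicate i b)))

permute-e : (π : Permutation′ n) (k : Fin n) → permute π (e k) ≡ e (π ⟨$⟩ˡ k)
permute-e π k = lookup-ext λ i → trans (lookup-permute π (e k) i) (at i)
  where
    at : ∀ i → lookup (e k) (π ⟨$⟩ʳ i) ≡ lookup (e (π ⟨$⟩ˡ k)) i
    at i with π ⟨$⟩ˡ k ≟ i
    ... | yes refl = trans (cong (lookup (e k)) (inverseʳ π)) (trans (lookup-e-diag k) (sym (lookup-e-diag (π ⟨$⟩ˡ k))))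
    ... | no  πk≢i =
      trans (lookup-e-≢ λ k≡πi → πk≢i (trans (cong (π ⟨$⟩ˡ_) k≡πi) (inverseˡ π))) (sym (lookup-e-≢ πk≢i))

weight≡sum : (v : Vertex n) → weight v ≡ sum (λ i → if lookup v i then 1 else 0)
weight≡sum []      = refl
weight≡sum (b ∷ v) = cong ((if b then 1 else 0) +_) (weight≡sum v)

weight-permute : (π : Permutation′ n) (v : Vertex n) → weight (permute π v) ≡ weight v
weight-permute π v = begin
  weight (permute π v)                                ≡⟨ weight≡sum (permute π v) ⟩
  sum (λ i → if lookup (permute π v) i then 1 else 0) ≡⟨ sum-cong-≗ (λ i → cong (if_then 1 else 0) (lookup-permute π v i)) ⟩
  sum (λ i → if lookup v (π ⟨$⟩ʳ i) then 1 else 0)    ≡⟨ sum-permute (λ i → if lookup v i then 1 else 0) π ⟨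
  sum (λ i → if lookup v i then 1 else 0)             ≡⟨ weight≡sum v ⟨
  weight v                                            ∎
  where open ≡-Reasoning

weight-⊕-ones : (v : Vertex n) → weight (v ⊕ ones) + weight v ≡ n
weight-⊕-ones []          = refl
weight-⊕-ones (false ∷ v) = cong suc (weight-⊕-ones v)
weight-⊕-ones (true  ∷ v) = trans (+-suc (weight (v ⊕ ones)) (weight v)) (cong suc (weight-⊕-ones v))

parity : Vertex n → Bool
parity = foldr (λ _ → Bool) _xor_ false

parity-⊕ : (u v : Vertex n) → parity (u ⊕ v) ≡ parity u xor parity v
parity-⊕ []      []      = refl
parity-⊕ (a ∷ u) (b ∷ v) = trans (cong ((a xor b) xor_) (parity-⊕ u v)) (xor-interchange a b (parity u) (parity v))

odd : ℕ → Bool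
odd zero    = false
odd (suc m) = not (odd m)

parity≡odd-weight : (v : Vertex n) → parity v ≡ odd (weight v)
parity≡odd-weight []          = refl
parity≡odd-weight (false ∷ v) = parity≡odd-weight v
parity≡odd-weight (true  ∷ v) = cong not (parity≡odd-weight v)

Shifted : Permutation′ n → Bool → Vertex n → Set
Shifted {n} π c u = permute π u ≡ u ⊕ replicate n c

shifted-weight : (π : Permutation′ n) {u : Vertex n} → Shifted π true u → weight u + weight u ≡ n
shifted-weight π {u} shifted =
  trans (cong (_+ weight u) (trans (sym (weight-permute π u)) (cong weight shifted))) (weight-⊕-ones u)

shifted-⊕ : (π : Permutation′ n) {c d : Bool} {u v : Vertex n} →
            Shifted π c u → Shifted π d v → Shifted π (c xor d) (u ⊕ v)
shifted-⊕ {n} π {c} {d} {u} {v} shifted-u shifted-v = begin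
  permute π (u ⊕ v)                         ≡⟨ permute-⊕ π u v ⟩
  permute π u ⊕ permute π v                 ≡⟨ cong₂ _⊕_ shifted-u shifted-v ⟩
  (u ⊕ replicate n c) ⊕ (v ⊕ replicate n d) ≡⟨ ⊕-interchange u (replicate n c) v (replicate n d) ⟩
  (u ⊕ v) ⊕ (replicate n c ⊕ replicate n d) ≡⟨ cong ((u ⊕ v) ⊕_) (zipWith-replicate _xor_ c d) ⟩
  (u ⊕ v) ⊕ replicate n (c xor d)           ∎
  where open ≡-Reasoning

-- For c = false compare u with u ⊕ w, which is shifted by true.
shifted-parity : (π : Permutation′ n) {b c : Bool} {u w : Vertex n} →
                 (∀ m → m + m ≡ n → odd m ≡ b) → Shifted π true w → Shifted π c u → parity u ≡ c ∧ b
shifted-parity π {c = true} {u} halves _ shifted-u =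
  trans (parity≡odd-weight u) (halves (weight u) (shifted-weight π shifted-u))
shifted-parity π {b} {false} {u} {w} halves shifted-w shifted-u = xor≡ʳ⇒false (begin
  parity u xor b        ≡⟨ cong (parity u xor_) (parity-of shifted-w) ⟨
  parity u xor parity w ≡⟨ parity-⊕ u w ⟨
  parity (u ⊕ w)        ≡⟨ parity-of (shifted-⊕ π shifted-u shifted-w) ⟩
  b                     ∎)
  where
    open ≡-Reasoning
    parity-of : ∀ {v} → Shifted π true v → parity v ≡ b
    parity-of {v} shifted = trans (parity≡odd-weight v) (halves (weight v) (shifted-weight π shifted))
    xor≡ʳ⇒false : ∀ {a} → a xor b ≡ b → a ≡ false
    xor≡ʳ⇒false {false} _  = refl
    xor≡ʳ⇒false {true}  eq = contradiction (sym eq) (not-¬ refl)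

double≡suc⇒mod4 : ∀ m {n} → m + m ≡ suc n → n % 4 ≡ (if odd m then 1 else 3)
double≡suc⇒mod4 (suc zero)          refl = refl
double≡suc⇒mod4 (suc (suc zero))    refl = refl
double≡suc⇒mod4 (suc (suc (suc m))) {n} eq = begin
  n % 4                                      ≡⟨ cong (_% 4) n≡ ⟩
  (m + suc m + 4) % 4                        ≡⟨ [m+n]%n≡m%n (m + suc m) 4 ⟩
  (m + suc m) % 4                            ≡⟨ double≡suc⇒mod4 (suc m) refl ⟩
  (if odd (suc m) then 1 else 3)             ≡⟨ cong (if_then 1 else 3) (not-involutive (odd (suc m))) ⟨
  (if odd (suc (suc (suc m))) then 1 else 3) ∎
  where
    open ≡-Reasoning
    rearrange : ∀ m → suc (suc (m + suc (suc (suc m)))) ≡ m + suc m + 4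
    rearrange = solve-∀
    n≡ : n ≡ m + suc m + 4
    n≡ = trans (suc-injective (sym eq)) (rearrange m)

double≡suc⇒mod2 : ∀ m {n} → m + m ≡ suc n → n % 2 ≡ 1
double≡suc⇒mod2 m {n} eq =
  trans (sym (m∣n⇒o%n%m≡o%m 2 4 n (divides 2 refl))) (trans (cong (_% 2) (double≡suc⇒mod4 m eq)) (either-odd (odd m)))
  where
    either-odd : ∀ b → (if b then 1 else 3) % 2 ≡ 1
    either-odd true  = refl
    either-odd false = refl

double≡suc⇒odd : ∀ m {n} → n % 4 ≡ 1 → m + m ≡ suc n → odd m ≡ true
double≡suc⇒odd m n%4≡1 eq with odd m | double≡suc⇒mod4 m eq
... | true  | _     = refl
... | false | n%4≡3 = contradiction (trans (sym n%4≡1) n%4≡3) λ ()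

double≡suc⇒even : ∀ m {n} → n % 4 ≡ 3 → m + m ≡ suc n → odd m ≡ false
double≡suc⇒even m n%4≡3 eq with odd m | double≡suc⇒mod4 m eq
... | false | _     = refl
... | true  | n%4≡1 = contradiction (trans (sym n%4≡3) n%4≡1) λ ()

≢zeros⇒∃true : (v : Vertex n) → v ≢ zeros → ∃ λ i → lookup v i ≡ true
≢zeros⇒∃true []          v≢0 = contradiction refl v≢0
≢zeros⇒∃true (true  ∷ v) _   = zero , refl
≢zeros⇒∃true (false ∷ v) v≢0 with ≢zeros⇒∃true v (v≢0 ∘ cong (false ∷_))
... | i , vi≡true = suc i , vi≡true

module Linearity {n} (4≤n : 4 ≤ n) (g : Vertex n → Vertex n)
                 (g-injective : ∀ {x y} → g x ≡ g y → x ≡ y)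
                 (g-adj : ∀ {u v} → Adj n u v → Adj n (g u) (g v))
                 (g-zeros : g zeros ≡ zeros) where

  open ≡-Reasoning

  private
    2≤n : 2 ≤ n
    2≤n = ≤-trans (s≤s (s≤s z≤n)) 4≤n

  neighbour : ∀ u k → ∃ λ γ → g (u ⊕ dir k) ≡ g u ⊕ dir γ
  neighbour u k = Adj⇒≡⊕-dir (g-adj (Adj-⊕-dir u k))

  σ : Fin (suc n) → Fin (suc n)
  σ k = proj₁ (neighbour zeros k)

  g-dir : (k : Fin (suc n)) → g (dir k) ≡ dir (σ k)
  g-dir k = begin
    g (dir k)           ≡⟨ cong g (⊕-identityˡ (dir k)) ⟨
    g (zeros ⊕ dir k)   ≡⟨ proj₂ (neighbour zeros k) ⟩
    g zeros ⊕ dir (σ k) ≡⟨ cong (_⊕ dir (σ k)) g-zeros ⟩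
    zeros ⊕ dir (σ k)   ≡⟨ ⊕-identityˡ (dir (σ k)) ⟩
    dir (σ k)           ∎

  σ-injective : ∀ {a b} → σ a ≡ σ b → a ≡ b
  σ-injective {a} {b} eq = dir-injective 2≤n (g-injective (trans (g-dir a) (trans (cong dir eq) (sym (g-dir b)))))

  Additive : Vertex n → Set
  Additive x = ∀ k → g (x ⊕ dir k) ≡ g x ⊕ dir (σ k)

  additive-zeros : Additive zeros
  additive-zeros k = begin
    g (zeros ⊕ dir k)   ≡⟨ cong g (⊕-identityˡ (dir k)) ⟩
    g (dir k)           ≡⟨ g-dir k ⟩
    dir (σ k)           ≡⟨ ⊕-identityˡ (dir (σ k)) ⟨
    zeros ⊕ dir (σ k)   ≡⟨ cong (_⊕ dir (σ k)) g-zeros ⟨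
    g zeros ⊕ dir (σ k) ∎

  -- g y, for y = x ⊕ dir a ⊕ dir b, is a common neighbour of g x ⊕ dir (σ a) and g x ⊕ dir (σ b) other
  -- than g x, so it is g x ⊕ dir (σ a) ⊕ dir (σ b).
  additive-step-≢ : ∀ x {a b} → Additive x → a ≢ b → g (x ⊕ dir a ⊕ dir b) ≡ g (x ⊕ dir a) ⊕ dir (σ b)
  additive-step-≢ x {a} {b} add a≢b = conclude (dir-square 4≤n {δ = δ} (a≢b ∘ σ-injective) square)
    where
      γ = proj₁ (neighbour (x ⊕ dir a) b)
      δ = proj₁ (neighbour (x ⊕ dir b) a)
      via-a : g (x ⊕ dir a ⊕ dir b) ≡ g x ⊕ dir (σ a) ⊕ dir γ
      via-a = trans (proj₂ (neighbour (x ⊕ dir a) b)) (cong (_⊕ dir γ) (add a))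
      swap : x ⊕ dir b ⊕ dir a ≡ x ⊕ dir a ⊕ dir b
      swap = trans (⊕-assoc x (dir b) (dir a))
                   (trans (cong (x ⊕_) (⊕-comm (dir b) (dir a))) (sym (⊕-assoc x (dir a) (dir b))))
      via-b : g (x ⊕ dir a ⊕ dir b) ≡ g x ⊕ dir (σ b) ⊕ dir δ
      via-b = trans (cong g (sym swap)) (trans (proj₂ (neighbour (x ⊕ dir b) a)) (cong (_⊕ dir δ) (add b)))
      square : dir (σ a) ⊕ dir γ ≡ dir (σ b) ⊕ dir δ
      square = ⊕-cancelˡ (g x) (trans (sym (⊕-assoc (g x) _ _)) (trans (sym via-a) (trans via-b (⊕-assoc (g x) _ _))))
      conclude : γ ≡ σ a ⊎ γ ≡ σ b → g (x ⊕ dir a ⊕ dir b) ≡ g (x ⊕ dir a) ⊕ dir (σ b)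
      conclude (inj₂ γ≡σb) = trans (proj₂ (neighbour (x ⊕ dir a) b)) (cong (λ k → g (x ⊕ dir a) ⊕ dir k) γ≡σb)
      conclude (inj₁ γ≡σa) = contradiction (dir-injective 2≤n (⊕≡zeros⇒≡ (⊕-cancelˡ x y≡x))) a≢b
        where
          gy≡gx : g (x ⊕ dir a ⊕ dir b) ≡ g x
          gy≡gx = trans via-a (trans (cong (λ k → g x ⊕ dir (σ a) ⊕ dir k) γ≡σa) (x⊕y⊕y≡x (g x) (dir (σ a))))
          y≡x : x ⊕ (dir a ⊕ dir b) ≡ x ⊕ zeros
          y≡x = trans (sym (⊕-assoc x (dir a) (dir b))) (trans (g-injective gy≡gx) (sym (⊕-identityʳ x)))

  additive-step : ∀ x a → Additive x → Additive (x ⊕ dir a)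
  additive-step x a add b with a ≟ b
  ... | no  a≢b  = additive-step-≢ x add a≢b
  ... | yes refl = begin
    g (x ⊕ dir a ⊕ dir a)       ≡⟨ cong g (x⊕y⊕y≡x x (dir a)) ⟩
    g x                         ≡⟨ x⊕y⊕y≡x (g x) (dir (σ a)) ⟨
    g x ⊕ dir (σ a) ⊕ dir (σ a) ≡⟨ cong (_⊕ dir (σ a)) (add a) ⟨
    g (x ⊕ dir a) ⊕ dir (σ a)   ∎

  g-⊕-dir : ∀ x k → g (x ⊕ dir k) ≡ g x ⊕ dir (σ k)
  g-⊕-dir = ⊕-e-induction Additive additive-zeros (λ x j → additive-step x (suc j))

module Action {n} (4≤n : 4 ≤ n) (φ : Automorphism n) (φ-zeros : to φ zeros ≡ zeros) where

  open ≡-Reasoning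

  private
    2≤n : 2 ≤ n
    2≤n = ≤-trans (s≤s (s≤s z≤n)) 4≤n

    from-zeros : from φ zeros ≡ zeros
    from-zeros = trans (cong (from φ) (sym φ-zeros)) (from-to φ zeros)

    from-adj : ∀ {u v} → Adj n u v → Adj n (from φ u) (from φ v)
    from-adj {u} {v} adj = adj-from φ _ _ (subst₂ (Adj n) (sym (to-from φ u)) (sym (to-from φ v)) adj)

    to-injective : ∀ {x y} → to φ x ≡ to φ y → x ≡ y
    to-injective {x} {y} eq = trans (sym (from-to φ x)) (trans (cong (from φ) eq) (from-to φ y))

    from-injective : ∀ {x y} → from φ x ≡ from φ y → x ≡ y
    from-injective {x} {y} eq = trans (sym (to-from φ x)) (trans (cong (to φ) eq) (to-from φ y))

  module Φ   = Linearity 4≤n (to φ)   to-injective   (adj-to φ _ _) φ-zeros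
  module Φ⁻¹ = Linearity 4≤n (from φ) from-injective from-adj       from-zeros

  -- π ⟨$⟩ˡ_ is the action of φ on the directions and π ⟨$⟩ʳ_ that of φ⁻¹.
  π : Permutation′ (suc n)
  π = permutation Φ⁻¹.σ Φ.σ
    (λ k → dir-injective 2≤n (begin
      dir (Φ⁻¹.σ (Φ.σ k))   ≡⟨ Φ⁻¹.g-dir (Φ.σ k) ⟨
      from φ (dir (Φ.σ k))  ≡⟨ cong (from φ) (Φ.g-dir k) ⟨
      from φ (to φ (dir k)) ≡⟨ from-to φ (dir k) ⟩
      dir k                 ∎))
    (λ k → dir-injective 2≤n (begin
      dir (Φ.σ (Φ⁻¹.σ k))   ≡⟨ Φ.g-dir (Φ⁻¹.σ k) ⟨
      to φ (dir (Φ⁻¹.σ k))  ≡⟨ cong (to φ) (Φ⁻¹.g-dir k) ⟨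
      to φ (from φ (dir k)) ≡⟨ to-from φ (dir k) ⟩
      dir k                 ∎))

  to-project : (E : Vertex (suc n)) → to φ (project E) ≡ project (permute π E)
  to-project = ⊕-e-induction (λ E → to φ (project E) ≡ project (permute π E)) base step
    where
      base : to φ (project zeros) ≡ project (permute π zeros)
      base = begin
        to φ (project zeros)      ≡⟨ cong (to φ) (project-false∷ zeros) ⟩
        to φ zeros                ≡⟨ φ-zeros ⟩
        zeros                     ≡⟨ project-false∷ zeros ⟨
        project zeros             ≡⟨ cong project (permute-replicate π false) ⟨
        project (permute π zeros) ∎
      step : ∀ E k → to φ (project E) ≡ project (permute π E) →
             to φ (project (E ⊕ e k)) ≡ project (permute π (E ⊕ e k))
      step E k ih = begin
        to φ (project (E ⊕ e k))                    ≡⟨ cong (to φ) (project-⊕ E (e k)) ⟩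
        to φ (project E ⊕ project (e k))            ≡⟨ cong (λ w → to φ (project E ⊕ w)) (project-e k) ⟩
        to φ (project E ⊕ dir k)                    ≡⟨ Φ.g-⊕-dir (project E) k ⟩
        to φ (project E) ⊕ dir (Φ.σ k)              ≡⟨ cong₂ _⊕_ ih (sym (project-e (Φ.σ k))) ⟩
        project (permute π E) ⊕ project (e (Φ.σ k)) ≡⟨ project-⊕ (permute π E) (e (Φ.σ k)) ⟨
        project (permute π E ⊕ e (Φ.σ k))           ≡⟨ cong (λ w → project (permute π E ⊕ w)) (permute-e π k) ⟨
        project (permute π E ⊕ permute π (e k))     ≡⟨ cong project (permute-⊕ π E (e k)) ⟨
        project (permute π (E ⊕ e k))               ∎

  fixed⇒shifted : (s : Vertex n) → to φ s ≡ s → Shifted π (lookup (false ∷ s) (π ⟨$⟩ʳ zero)) (false ∷ s)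
  fixed⇒shifted s fixed = ⊕≡⇒≡⊕ (false ∷ s) (begin
    (false ∷ s) ⊕ permute π (false ∷ s) ≡⟨ ⊕-comm (false ∷ s) (permute π (false ∷ s)) ⟩
    permute π (false ∷ s) ⊕ (false ∷ s) ≡⟨ project-kernel (permute π (false ∷ s) ⊕ (false ∷ s)) vanishes ⟩
    replicate (suc n) (c xor false)     ≡⟨ cong (replicate (suc n)) (xor-identityʳ c) ⟩
    replicate (suc n) c                 ∎)
    where
      c = lookup (false ∷ s) (π ⟨$⟩ʳ zero)
      vanishes : project (permute π (false ∷ s) ⊕ (false ∷ s)) ≡ zeros
      vanishes = begin
        project (permute π (false ∷ s) ⊕ (false ∷ s))         ≡⟨ project-⊕ (permute π (false ∷ s)) (false ∷ s) ⟩
        project (permute π (false ∷ s)) ⊕ project (false ∷ s) ≡⟨ cong (_⊕ project (false ∷ s)) (to-project (false ∷ s)) ⟨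
        to φ (project (false ∷ s)) ⊕ project (false ∷ s)      ≡⟨ cong (λ x → to φ x ⊕ x) (project-false∷ s) ⟩
        to φ s ⊕ s                                            ≡⟨ cong (_⊕ s) fixed ⟩
        s ⊕ s                                                 ≡⟨ ⊕-self s ⟩
        zeros                                                 ∎

module PointwiseStabiliser {n r} (4≤n : 4 ≤ n) (S : Vec (Vertex n) r) (φ : Automorphism n)
               (fixes : ∀ t → to φ (lookup S t) ≡ lookup S t)
               (zero-row : ∃ λ t → row S t ≡ replicate n false) where

  open ≡-Reasoning

  φ-zeros : to φ zeros ≡ zeros
  φ-zeros = subst (λ v → to φ v ≡ v) (trans (sym (tabulate∘lookup (lookup S t₀))) row₀) (fixes t₀)
    where open Σ zero-row renaming (proj₁ to t₀; proj₂ to row₀)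

  open Action 4≤n φ φ-zeros using (π; to-project; fixed⇒shifted) public

  Ŝ : Fin r → Vertex (suc n)
  Ŝ t = false ∷ lookup S t

  row-shifted : ∀ {k} → π ⟨$⟩ʳ zero ≡ k → ∀ t → Shifted π (lookup (Ŝ t) k) (Ŝ t)
  row-shifted π0 t = subst (λ k → Shifted π (lookup (Ŝ t) k) (Ŝ t)) π0 (fixed⇒shifted (lookup S t) (fixes t))

  column≡ : ∀ {i} {v : Vec Bool r} → (∀ t → X S t i ≡ lookup v t) → column S i ≡ v
  column≡ {i} eq = lookup-ext λ t → trans (lookup∘tabulate (λ t → X S t i) t) (eq t)

  lookup-columnSum : ∀ {j b} → π ⟨$⟩ʳ zero ≡ suc j → ∀ {w} → Shifted π true w →
                     (∀ m → m + m ≡ suc n → odd m ≡ b) → ∀ t → lookup (columnSum S) t ≡ X S t j ∧ b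
  lookup-columnSum {j} {b} π0 flipped halves t = begin
    lookup (columnSum S) t ≡⟨ lookup∘tabulate (λ t → parity (row S t)) t ⟩
    parity (row S t)       ≡⟨ cong parity (tabulate∘lookup (lookup S t)) ⟩
    parity (Ŝ t)           ≡⟨ shifted-parity π halves flipped (row-shifted π0 t) ⟩
    X S t j ∧ b            ∎

  module _ (column-injective : ∀ i j → column S i ≡ column S j → i ≡ j)
           (column-nonzero : ∀ j → ¬ (column S j ≡ replicate r false)) where

    extended-column-injective : ∀ {a b} → (∀ t → lookup (Ŝ t) a ≡ lookup (Ŝ t) b) → a ≡ b
    extended-column-injective {zero}  {zero}  _  = refl
    extended-column-injective {zero}  {suc j} eq =
      contradiction (column≡ λ t → trans (sym (eq t)) (sym (lookup-replicate t false))) (column-nonzero j)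
    extended-column-injective {suc i} {zero}  eq =
      contradiction (column≡ λ t → trans (eq t) (sym (lookup-replicate t false))) (column-nonzero i)
    extended-column-injective {suc i} {suc j} eq =
      cong suc (column-injective i j (column≡ λ t → trans (eq t) (sym (lookup∘tabulate (λ t → X S t j) t))))

    π-zero⇒identity : π ⟨$⟩ʳ zero ≡ zero → ∀ x → to φ x ≡ x
    π-zero⇒identity π0 x = begin
      to φ x                          ≡⟨ cong (to φ) (project-false∷ x) ⟨
      to φ (project (false ∷ x))      ≡⟨ to-project (false ∷ x) ⟩
      project (permute π (false ∷ x)) ≡⟨ cong project (lookup-ext λ k →
                                           trans (lookup-permute π (false ∷ x) k) (cong (lookup (false ∷ x)) (π-identity k))) ⟩
      project (false ∷ x)             ≡⟨ project-false∷ x ⟩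
      x                               ∎
      where
        row-fixed : ∀ t k → lookup (Ŝ t) (π ⟨$⟩ʳ k) ≡ lookup (Ŝ t) k
        row-fixed t k = begin
          lookup (Ŝ t) (π ⟨$⟩ʳ k)    ≡⟨ lookup-permute π (Ŝ t) k ⟨
          lookup (permute π (Ŝ t)) k ≡⟨ cong (λ v → lookup v k) (row-shifted π0 t) ⟩
          lookup (Ŝ t ⊕ zeros) k     ≡⟨ cong (λ v → lookup v k) (⊕-identityʳ (Ŝ t)) ⟩
          lookup (Ŝ t) k             ∎
        π-identity : ∀ k → π ⟨$⟩ʳ k ≡ k
        π-identity k = extended-column-injective (λ t → row-fixed t k)

    π-suc⇒flipped-row : ∀ {j} → π ⟨$⟩ʳ zero ≡ suc j → ∃ λ t → Shifted π true (Ŝ t)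
    π-suc⇒flipped-row {j} π0 with ≢zeros⇒∃true (column S j) (column-nonzero j)
    ... | t , entry =
      t , subst (λ c → Shifted π c (Ŝ t)) (trans (sym (lookup∘tabulate (λ t → X S t j) t)) entry) (row-shifted π0 t)

corollary5p5 : (n r : ℕ) → 4 ≤ n → (S : Vec (Vertex n) r)
    → (∀ s t → lookup S s ≡ lookup S t → s ≡ t)
    → (∃ λ t → row S t ≡ replicate n false)
    → (∀ i j → column S i ≡ column S j → i ≡ j)
    → (∀ j → ¬ (column S j ≡ replicate r false))
    → ((n % 2 ≡ 0)
    ⊎ ((n % 4 ≡ 1) × (∀ j → ¬ (columnSum S ≡ column S j)))
    ⊎ ((n % 4 ≡ 3) × ¬ (columnSum S ≡ replicate r false)))
    → IsDeterminingSet n S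
corollary5p5 n r 4≤n S _ zero-row column-injective column-nonzero condition φ fixes =
  by-image-of-zero (π ⟨$⟩ʳ zero) refl
  where
    open PointwiseStabiliser 4≤n S φ fixes zero-row
    by-image-of-zero : ∀ k → π ⟨$⟩ʳ zero ≡ k → ∀ x → to φ x ≡ x
    by-image-of-zero zero    π0 = π-zero⇒identity column-injective column-nonzero π0
    by-image-of-zero (suc j) π0 = ⊥-elim (excluded condition)
      where
        t = proj₁ (π-suc⇒flipped-row column-injective column-nonzero π0)
        flipped : Shifted π true (Ŝ t)
        flipped = proj₂ (π-suc⇒flipped-row column-injective column-nonzero π0)
        halves : weight (Ŝ t) + weight (Ŝ t) ≡ suc n
        halves = shifted-weight π flipped
        excluded : _ → ⊥
        excluded (inj₁ n%2≡0) = contradiction (trans (sym n%2≡0) (double≡suc⇒mod2 (weight (Ŝ t)) halves)) λ ()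
        excluded (inj₂ (inj₁ (n%4≡1 , columnSum≢column))) = columnSum≢column j (sym (column≡ λ t →
          sym (trans (lookup-columnSum π0 flipped (λ m → double≡suc⇒odd m n%4≡1) t) (∧-identityʳ (X S t j)))))
        excluded (inj₂ (inj₂ (n%4≡3 , columnSum≢zeros))) = columnSum≢zeros (lookup-ext λ t →
          trans (lookup-columnSum π0 flipped (λ m → double≡suc⇒even m n%4≡3) t)
                (trans (∧-zeroʳ (X S t j)) (sym (lookup-replicate t false))))
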